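{- Suppose $\mathsf{Gen}_1: \{0,1\}^{s_1} \to \{0,1\}^{nk_1}$ is a $\gamma_1$-PRG for $(k_1, n, \Sigma)$ block decision trees and $\mathsf{Gen}_2: \{0,1\}^{s_2} \to \{0,1\}^{nk_2}$ is a $\gamma_2$-PRG for $(k_2, n, \Sigma)$ block decision trees. Let $\mathsf{Gen}(x,y) = (\mathsf{Gen}_1(x), \mathsf{Gen}_2(y))$. Then $\mathsf{Gen}$ is a $(\gamma_1+\gamma_2)$-PRG for $(k_1+k_2, n, \Sigma)$ block decision trees.
   Context: A $(k,n,\Sigma)$ block decision tree ($\Sigma$ a finite alphabet) is a rooted tree of height $k$ in which every node $v$ at depth $<k$ has exactly $|\Sigma|$ children, labeled by the symbols of $\Sigma$, and an associated function $v:\{0,1\}^n\to\Sigma$; it defines $T:(\{0,1\}^n)^{\le k}\to V$ by $T(\text{empty}) =$ root and, if $T(X_1,\dots,X_{i-1}) = v$, then $T(X_1,\dots,X_i)$ is the child of $v$ labeled $v(X_i)$. $U_m$ denotes the uniform distribution on $\{0,1\}^m$. $\mathsf{Gen}:\{0,1\}^s\to\{0,1\}^{nk}$ is a $\gamma$-PRG for $(k,n,\Sigma)$ block decision trees if for every such tree $T$, $T(\mathsf{Gen}(U_s))$ and $T(U_{nk})$ have total variation distance at most $\gamma$.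
   Formalization: The errors $\gamma_1$ and $\gamma_2$, and the error γ in the definition of a γ-PRG, are rational. -}

module Defs where

open import Data.Bool using (Bool; true; false)
open import Data.Nat as ℕ using (ℕ; zero; suc; _^_)
open import Data.Nat.Properties using (m^n≢0)
open import Data.Fin using (Fin)
open import Data.Vec using (Vec; []; _∷_; _++_; splitAt)
open import Data.List using (List; []; _∷_; map; concatMap; length; filter)
open import Data.List.Base using (allFin)
open import Data.Product using (_×_; _,_; proj₁)
open import Data.Integer using (+_)
open import Data.Rational using (ℚ; _/_; _-_; _+_; ∣_∣; _*_; ½; 0ℚ)
open import Data.Vec.Properties using (≡-dec)
open import Data.Fin.Properties using (_≟_)
open import Relation.Binary.PropositionalEquality using (_≡_)
open import Relation.Nullary using (Dec)

Bits : ℕ → Set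
Bits m = Vec Bool m

allVecs : {A : Set} → List A → (m : ℕ) → List (Vec A m)
allVecs xs zero    = [] ∷ []
allVecs xs (suc m) = concatMap (λ x → map (x ∷_) (allVecs xs m)) xs

allBits : (m : ℕ) → List (Bits m)
allBits = allVecs (true ∷ false ∷ [])

-- Alphabet Σ is Fin q (a finite alphabet of size q).
-- A (k, n, Fin q) block decision tree: a complete q-ary tree of height k
-- whose internal nodes carry functions {0,1}^n → Σ.
data BDT (n q : ℕ) : ℕ → Set where
  leaf : BDT n q zero
  node : {k : ℕ} → (Bits n → Fin q) → (Fin q → BDT n q k) → BDT n q (suc k)

-- T(X_1,...,X_k): the depth-k node reached, identified with its
-- root-to-node path of child labels (a word in Σ^k).
run : {n q k : ℕ} → BDT n q k → Vec (Bits n) k → Vec (Fin q) k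
run leaf         []       = []
run (node f ch)  (x ∷ xs) = f x ∷ run (ch (f x)) xs

-- An element of {0,1}^{nk} viewed as k blocks of n bits.
Blocks : ℕ → ℕ → Set
Blocks n k = Vec (Bits n) k

allBlocks : (n k : ℕ) → List (Blocks n k)
allBlocks n k = allVecs (allBits n) k

count : {A : Set} → (A → Bool) → List A → ℕ
count p xs = length (filter (λ a → Data.Bool.T? (p a)) xs)
  where import Data.Bool

eqPath : {q k : ℕ} → Vec (Fin q) k → Vec (Fin q) k → Bool
eqPath u v = Relation.Nullary.does (≡-dec _≟_ u v)
  where import Relation.Nullary

prob : (m : ℕ) → {A : Set} → List A → (A → Bool) → ℚ
prob m xs p = (+ count p xs) / (2 ^ m)
  where instance _ = m^n≢0 2 m

sumℚ : List ℚ → ℚ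
sumℚ []       = 0ℚ
sumℚ (x ∷ xs) = x + sumℚ xs

-- total variation distance between T(Gen(U_s)) and T(U_{nk}), where the
-- leaves of T are enumerated as all words in Σ^k:
--   (1/2) Σ_leaf | Pr[T(Gen(U_s)) = leaf] - Pr[T(U_{nk}) = leaf] |
tvDist : {n q k s : ℕ} → BDT n q k → (Bits s → Blocks n k) → ℚ
tvDist {n} {q} {k} {s} T gen =
  ½ * sumℚ (map (λ ℓ → ∣ prob s (allBits s) (λ x → eqPath (run T (gen x)) ℓ)
                         - prob (n ℕ.* k) (allBlocks n k) (λ X → eqPath (run T X) ℓ) ∣)
                (allVecs (allFin q) k))

IsPRG : (n q k s : ℕ) → (Bits s → Blocks n k) → ℚ → Set
IsPRG n q k s gen γ = (T : BDT n q k) → tvDist T gen Data.Rational.≤ γ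
  where import Data.Rational

combine : {n k₁ k₂ s₁ s₂ : ℕ} → (Bits s₁ → Blocks n k₁) → (Bits s₂ → Blocks n k₂)
        → Bits (s₁ ℕ.+ s₂) → Blocks n (k₁ ℕ.+ k₂)
combine {s₁ = s₁} g₁ g₂ z with splitAt s₁ z
... | x , y , _ = g₁ x ++ g₂ y

module Submission where

open import Defs
open import Data.Nat using (ℕ; _+_)
open import Data.Rational using (ℚ)
import Data.Rational

open import Algebra.Bundles using (CommutativeSemiring; CommutativeRing)
open import Data.Bool using (Bool; true; false; _∧_)
open import Data.Fin using (Fin)
import Data.Fin as Fin
open import Data.Fin.Properties using (_≟_)
open import Data.List using (List; []; _∷_; map; concatMap; length; allFin)
import Data.List as List
open import Data.List.Properties using (map-tabulate)
import Data.Nat as ℕ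
open import Data.Product using (_,_)
open import Data.Vec using (Vec; []; _∷_; _++_; splitAt)
open import Data.Vec.Properties using (≡-dec)
open import Function using (_∘_)
open import Relation.Nullary using (does; yes; no)

-- Over a uniform seed the two halves of Gen(x, y) are independent, so the path distribution of a
-- tree T of height k₁ + k₂ factors as P(u) · Q_u(v), where P is the distribution of the first k₁
-- labels u under Gen₁ and Q_u that of the last k₂ labels under Gen₂ in the subtree reached by u;
-- the same holds for truly uniform blocks, with R(u) · S_u(v). The hybrid estimate
-- |P Q_u − R S_u| ≤ |P − R| Q_u + R |Q_u − S_u| splits the distance into the distance of the
-- prefix tree (at most γ₁) plus an R-average of distances of subtrees (each at most γ₂).

module ListSum {c ℓ} (R : CommutativeSemiring c ℓ) where

  open CommutativeSemiring R renaming (_+_ to _⊕_)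
  open import Algebra.Properties.CommutativeSemigroup +-commutativeSemigroup using (interchange)
  open import Relation.Binary.Reasoning.Setoid setoid

  ∑ : {A : Set} → (A → Carrier) → List A → Carrier
  ∑ f []       = 0#
  ∑ f (x ∷ xs) = f x ⊕ ∑ f xs

  ∑-cong : {A : Set} {f g : A → Carrier} → (∀ x → f x ≈ g x) → ∀ xs → ∑ f xs ≈ ∑ g xs
  ∑-cong f≈g []       = refl
  ∑-cong f≈g (x ∷ xs) = +-cong (f≈g x) (∑-cong f≈g xs)

  ∑-0# : {A : Set} (xs : List A) → ∑ (λ _ → 0#) xs ≈ 0#
  ∑-0# []       = refl
  ∑-0# (x ∷ xs) = trans (+-congˡ (∑-0# xs)) (+-identityˡ 0#)

  ∑-++ : {A : Set} (f : A → Carrier) (xs ys : List A) → ∑ f (xs List.++ ys) ≈ ∑ f xs ⊕ ∑ f ys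
  ∑-++ f []       ys = sym (+-identityˡ _)
  ∑-++ f (x ∷ xs) ys = trans (+-congˡ (∑-++ f xs ys)) (sym (+-assoc _ _ _))

  ∑-map : {A B : Set} (f : B → Carrier) (g : A → B) (xs : List A) → ∑ f (map g xs) ≈ ∑ (f ∘ g) xs
  ∑-map f g []       = refl
  ∑-map f g (x ∷ xs) = +-congˡ (∑-map f g xs)

  ∑-concatMap : {A B : Set} (f : B → Carrier) (h : A → List B) (xs : List A) →
                ∑ f (concatMap h xs) ≈ ∑ (λ x → ∑ f (h x)) xs
  ∑-concatMap f h []       = refl
  ∑-concatMap f h (x ∷ xs) = trans (∑-++ f (h x) (concatMap h xs)) (+-congˡ (∑-concatMap f h xs))

  ∑-⊕ : {A : Set} (f g : A → Carrier) (xs : List A) → ∑ (λ x → f x ⊕ g x) xs ≈ ∑ f xs ⊕ ∑ g xs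
  ∑-⊕ f g []       = sym (+-identityˡ 0#)
  ∑-⊕ f g (x ∷ xs) = trans (+-congˡ (∑-⊕ f g xs)) (interchange _ _ _ _)

  ∑-swap : {A B : Set} (F : A → B → Carrier) (xs : List A) (ys : List B) →
           ∑ (λ x → ∑ (F x) ys) xs ≈ ∑ (λ y → ∑ (λ x → F x y) xs) ys
  ∑-swap F []       ys = sym (∑-0# ys)
  ∑-swap F (x ∷ xs) ys = trans (+-congˡ (∑-swap F xs ys)) (sym (∑-⊕ (F x) _ ys))

  ∑-*ˡ : {A : Set} (a : Carrier) (f : A → Carrier) (xs : List A) → ∑ (λ x → a * f x) xs ≈ a * ∑ f xs
  ∑-*ˡ a f []       = sym (zeroʳ a)
  ∑-*ˡ a f (x ∷ xs) = trans (+-congˡ (∑-*ˡ a f xs)) (sym (distribˡ a (f x) _))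

  ∑-*ʳ : {A : Set} (a : Carrier) (f : A → Carrier) (xs : List A) → ∑ (λ x → f x * a) xs ≈ ∑ f xs * a
  ∑-*ʳ a f []       = sym (zeroˡ a)
  ∑-*ʳ a f (x ∷ xs) = trans (+-congˡ (∑-*ʳ a f xs)) (sym (distribʳ a (f x) _))

  ∑-allVecs-+ : {A : Set} (xs : List A) (m₁ m₂ : ℕ) (F : Vec A (m₁ + m₂) → Carrier) →
                ∑ F (allVecs xs (m₁ + m₂)) ≈ ∑ (λ a → ∑ (λ b → F (a ++ b)) (allVecs xs m₂)) (allVecs xs m₁)
  ∑-allVecs-+ xs ℕ.zero    m₂ F = sym (+-identityʳ _)
  ∑-allVecs-+ xs (ℕ.suc m₁) m₂ F = begin
    ∑ F (concatMap (λ x → map (x ∷_) (allVecs xs (m₁ + m₂))) xs)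
      ≈⟨ ∑-concatMap F _ xs ⟩
    ∑ (λ x → ∑ F (map (x ∷_) (allVecs xs (m₁ + m₂)))) xs
      ≈⟨ ∑-cong (λ x → trans (∑-map F (x ∷_) (allVecs xs (m₁ + m₂))) (∑-allVecs-+ xs m₁ m₂ (F ∘ (x ∷_)))) xs ⟩
    ∑ (λ x → ∑ (G ∘ (x ∷_)) (allVecs xs m₁)) xs
      ≈⟨ ∑-cong (λ x → ∑-map G (x ∷_) (allVecs xs m₁)) xs ⟨
    ∑ (λ x → ∑ G (map (x ∷_) (allVecs xs m₁))) xs
      ≈⟨ ∑-concatMap G _ xs ⟨
    ∑ G (concatMap (λ x → map (x ∷_) (allVecs xs m₁)) xs) ∎
    where
      G : Vec _ (ℕ.suc m₁) → Carrier
      G a = ∑ (λ b → F (a ++ b)) (allVecs xs m₂)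

import Data.Nat.Properties as ℕₚ
open import Relation.Binary.PropositionalEquality using (_≡_; refl; sym; trans; cong; cong₂; module ≡-Reasoning)

paths : (q k : ℕ) → List (Vec (Fin q) k)
paths q k = allVecs (allFin q) k

splitAt-++ : {A : Set} (m : ℕ) {k : ℕ} (x : Vec A m) (y : Vec A k) → splitAt m (x ++ y) ≡ (x , y , refl)
splitAt-++ ℕ.zero    []      y = refl
splitAt-++ (ℕ.suc m) (a ∷ x) y rewrite splitAt-++ m x y = refl

combine-++ : {n k₁ k₂ s₁ s₂ : ℕ} (g₁ : Bits s₁ → Blocks n k₁) (g₂ : Bits s₂ → Blocks n k₂)
             (x : Bits s₁) (y : Bits s₂) → combine g₁ g₂ (x ++ y) ≡ g₁ x ++ g₂ y
combine-++ {s₁ = s₁} g₁ g₂ x y with splitAt s₁ (x ++ y) | splitAt-++ s₁ x y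
... | .(x , y , refl) | refl = refl

module _ {n q : ℕ} where

  prefix : ∀ k₁ {k₂} → BDT n q (k₁ + k₂) → BDT n q k₁
  prefix ℕ.zero     T           = leaf
  prefix (ℕ.suc k₁) (node f ch) = node f (prefix k₁ ∘ ch)

  subtree : ∀ k₁ {k₂} → BDT n q (k₁ + k₂) → Vec (Fin q) k₁ → BDT n q k₂
  subtree ℕ.zero     T           []      = T
  subtree (ℕ.suc k₁) (node f ch) (a ∷ u) = subtree k₁ (ch a) u

  run-++ : ∀ k₁ {k₂} (T : BDT n q (k₁ + k₂)) (X : Blocks n k₁) (Y : Blocks n k₂) →
           run T (X ++ Y) ≡ run (prefix k₁ T) X ++ run (subtree k₁ T (run (prefix k₁ T) X)) Y
  run-++ ℕ.zero     T           []      Y = refl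
  run-++ (ℕ.suc k₁) (node f ch) (x ∷ X) Y = cong (f x ∷_) (run-++ k₁ (ch (f x)) X Y)

eqPath-++ : ∀ {q k₁ k₂} (a u : Vec (Fin q) k₁) (b v : Vec (Fin q) k₂) →
            eqPath (a ++ b) (u ++ v) ≡ eqPath a u ∧ eqPath b v
eqPath-++ []      []      b v = refl
eqPath-++ (x ∷ a) (y ∷ u) b v rewrite eqPath-++ a u b v = sym (∧-assoc (does (x ≟ y)) (eqPath a u) (eqPath b v))
  where open import Data.Bool.Properties using (∧-assoc)

module Counting where

  open ListSum ℕₚ.+-*-commutativeSemiring
  open ≡-Reasoning

  𝟙 : Bool → ℕ
  𝟙 true  = 1
  𝟙 false = 0

  count≡∑𝟙 : {A : Set} (p : A → Bool) (xs : List A) → count p xs ≡ ∑ (𝟙 ∘ p) xs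
  count≡∑𝟙 p []       = refl
  count≡∑𝟙 p (x ∷ xs) with p x
  ... | true  = cong ℕ.suc (count≡∑𝟙 p xs)
  ... | false = count≡∑𝟙 p xs

  count-cong : {A : Set} {p p′ : A → Bool} → (∀ x → p x ≡ p′ x) → ∀ xs → count p xs ≡ count p′ xs
  count-cong {p = p} {p′} p≡p′ xs =
    trans (count≡∑𝟙 p xs) (trans (∑-cong (cong 𝟙 ∘ p≡p′) xs) (sym (count≡∑𝟙 p′ xs)))

  count-∧ : {A : Set} (b : Bool) (p : A → Bool) (xs : List A) →
            count (λ x → b ∧ p x) xs ≡ 𝟙 b ℕ.* count p xs
  count-∧ true  p xs = sym (ℕₚ.+-identityʳ _)
  count-∧ false p xs = trans (count≡∑𝟙 _ xs) (∑-0# xs)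

  𝟙-eqPath-*-cong : ∀ {q k} (a u : Vec (Fin q) k) (F : Vec (Fin q) k → ℕ) →
                    𝟙 (eqPath a u) ℕ.* F a ≡ 𝟙 (eqPath a u) ℕ.* F u
  𝟙-eqPath-*-cong a u F with ≡-dec _≟_ a u
  ... | yes refl = refl
  ... | no _     = refl

  count-allVecs-+ : {A : Set} (xs : List A) (m₁ m₂ : ℕ) (p : Vec A (m₁ + m₂) → Bool) →
                    count p (allVecs xs (m₁ + m₂))
                      ≡ ∑ (λ a → count (λ b → p (a ++ b)) (allVecs xs m₂)) (allVecs xs m₁)
  count-allVecs-+ xs m₁ m₂ p =
    trans (count≡∑𝟙 p (allVecs xs (m₁ + m₂)))
      (trans (∑-allVecs-+ xs m₁ m₂ (𝟙 ∘ p))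
             (∑-cong (λ a → sym (count≡∑𝟙 _ (allVecs xs m₂))) (allVecs xs m₁)))

  count-run-++ : ∀ {n q k₁ k₂} {A B : Set} (T : BDT n q (k₁ + k₂)) (xs : List A) (ys : List B)
                 (f : A → Blocks n k₁) (g : B → Blocks n k₂) (u : Vec (Fin q) k₁) (v : Vec (Fin q) k₂) →
                 ∑ (λ x → count (λ y → eqPath (run T (f x ++ g y)) (u ++ v)) ys) xs
                   ≡ count (λ x → eqPath (run (prefix k₁ T) (f x)) u) xs
                     ℕ.* count (λ y → eqPath (run (subtree k₁ T u) (g y)) v) ys
  count-run-++ {k₁ = k₁} T xs ys f g u v = begin
    ∑ (λ x → count (λ y → eqPath (run T (f x ++ g y)) (u ++ v)) ys) xs
      ≡⟨ ∑-cong splitPath xs ⟩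
    ∑ (λ x → 𝟙 (eqPath (run T₁ (f x)) u) ℕ.* C u) xs
      ≡⟨ ∑-*ʳ (C u) _ xs ⟩
    ∑ (λ x → 𝟙 (eqPath (run T₁ (f x)) u)) xs ℕ.* C u
      ≡⟨ cong (ℕ._* C u) (count≡∑𝟙 _ xs) ⟨
    count (λ x → eqPath (run T₁ (f x)) u) xs ℕ.* C u ∎
    where
      T₁ = prefix k₁ T
      C : Vec _ k₁ → ℕ
      C w = count (λ y → eqPath (run (subtree k₁ T w) (g y)) v) ys
      splitPath : ∀ x → count (λ y → eqPath (run T (f x ++ g y)) (u ++ v)) ys
                        ≡ 𝟙 (eqPath (run T₁ (f x)) u) ℕ.* C u
      splitPath x = begin
        count (λ y → eqPath (run T (f x ++ g y)) (u ++ v)) ys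
          ≡⟨ count-cong (λ y → trans (cong (λ w → eqPath w (u ++ v)) (run-++ k₁ T (f x) (g y)))
                                     (eqPath-++ a u _ v)) ys ⟩
        count (λ y → eqPath a u ∧ eqPath (run (subtree k₁ T a) (g y)) v) ys
          ≡⟨ count-∧ (eqPath a u) _ ys ⟩
        𝟙 (eqPath a u) ℕ.* C a
          ≡⟨ 𝟙-eqPath-*-cong a u C ⟩
        𝟙 (eqPath a u) ℕ.* C u ∎
        where a = run T₁ (f x)

  count-combine-++ : ∀ {n q k₁ k₂ s₁ s₂} (T : BDT n q (k₁ + k₂))
                     (g₁ : Bits s₁ → Blocks n k₁) (g₂ : Bits s₂ → Blocks n k₂)
                     (u : Vec (Fin q) k₁) (v : Vec (Fin q) k₂) →
                     count (λ z → eqPath (run T (combine g₁ g₂ z)) (u ++ v)) (allBits (s₁ + s₂))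
                       ≡ count (λ x → eqPath (run (prefix k₁ T) (g₁ x)) u) (allBits s₁)
                         ℕ.* count (λ y → eqPath (run (subtree k₁ T u) (g₂ y)) v) (allBits s₂)
  count-combine-++ {s₁ = s₁} {s₂} T g₁ g₂ u v = begin
    count (λ z → eqPath (run T (combine g₁ g₂ z)) (u ++ v)) (allBits (s₁ + s₂))
      ≡⟨ count-allVecs-+ _ s₁ s₂ _ ⟩
    ∑ (λ x → count (λ y → eqPath (run T (combine g₁ g₂ (x ++ y))) (u ++ v)) (allBits s₂)) (allBits s₁)
      ≡⟨ ∑-cong (λ x → count-cong (λ y → cong (λ w → eqPath (run T w) (u ++ v)) (combine-++ g₁ g₂ x y))
                                  (allBits s₂)) (allBits s₁) ⟩
    ∑ (λ x → count (λ y → eqPath (run T (g₁ x ++ g₂ y)) (u ++ v)) (allBits s₂)) (allBits s₁)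
      ≡⟨ count-run-++ T (allBits s₁) (allBits s₂) g₁ g₂ u v ⟩
    _ ∎

  count-blocks-++ : ∀ {n q k₁ k₂} (T : BDT n q (k₁ + k₂)) (u : Vec (Fin q) k₁) (v : Vec (Fin q) k₂) →
                    count (λ X → eqPath (run T X) (u ++ v)) (allBlocks n (k₁ + k₂))
                      ≡ count (λ X → eqPath (run (prefix k₁ T) X) u) (allBlocks n k₁)
                        ℕ.* count (λ Y → eqPath (run (subtree k₁ T u) Y) v) (allBlocks n k₂)
  count-blocks-++ {n} {k₁ = k₁} {k₂} T u v =
    trans (count-allVecs-+ (allBits n) k₁ k₂ _) (count-run-++ T (allBlocks n k₁) (allBlocks n k₂) _ _ u v)

  ∑-allFin-suc : ∀ {q} (f : Fin (ℕ.suc q) → ℕ) →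
                 ∑ f (allFin (ℕ.suc q)) ≡ f Fin.zero + ∑ (f ∘ Fin.suc) (allFin q)
  ∑-allFin-suc {q} f = cong (f Fin.zero +_) (trans (cong (∑ f) (sym (map-tabulate (λ i → i) Fin.suc)))
                                                   (∑-map f Fin.suc (allFin q)))

  ∑𝟙-≟ : ∀ {q} (w : Fin q) → ∑ (λ i → 𝟙 (does (w ≟ i))) (allFin q) ≡ 1
  ∑𝟙-≟ {ℕ.suc q} Fin.zero    =
    trans (∑-allFin-suc {q} (λ i → 𝟙 (does (Fin.zero ≟ i)))) (cong ℕ.suc (∑-0# (allFin q)))
  ∑𝟙-≟ {ℕ.suc q} (Fin.suc w) = trans (∑-allFin-suc {q} (λ i → 𝟙 (does (Fin.suc w ≟ i)))) (∑𝟙-≟ w)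

  ∑𝟙-eqPath : ∀ {q k} (w : Vec (Fin q) k) → ∑ (λ ℓ → 𝟙 (eqPath w ℓ)) (paths q k) ≡ 1
  ∑𝟙-eqPath []                   = refl
  ∑𝟙-eqPath {q} {ℕ.suc k} (w₀ ∷ w) = begin
    ∑ (λ ℓ → 𝟙 (eqPath (w₀ ∷ w) ℓ)) (paths q (ℕ.suc k))
      ≡⟨ ∑-concatMap _ _ (allFin q) ⟩
    ∑ (λ i → ∑ (λ ℓ → 𝟙 (eqPath (w₀ ∷ w) ℓ)) (map (i ∷_) (paths q k))) (allFin q)
      ≡⟨ ∑-cong (λ i → trans (∑-map _ (i ∷_) (paths q k)) (∑𝟙-∧-eqPath (does (w₀ ≟ i)))) (allFin q) ⟩
    ∑ (λ i → 𝟙 (does (w₀ ≟ i))) (allFin q)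
      ≡⟨ ∑𝟙-≟ w₀ ⟩
    1 ∎
    where
      ∑𝟙-∧-eqPath : ∀ b → ∑ (λ ℓ → 𝟙 (b ∧ eqPath w ℓ)) (paths q k) ≡ 𝟙 b
      ∑𝟙-∧-eqPath true  = ∑𝟙-eqPath w
      ∑𝟙-∧-eqPath false = ∑-0# (paths q k)

  ∑-const : {A : Set} (a : ℕ) (xs : List A) → ∑ (λ _ → a) xs ≡ length xs ℕ.* a
  ∑-const a []       = refl
  ∑-const a (x ∷ xs) = cong (a +_) (∑-const a xs)

  ∑1≡length : {A : Set} (xs : List A) → ∑ (λ _ → 1) xs ≡ length xs
  ∑1≡length xs = trans (∑-const 1 xs) (ℕₚ.*-identityʳ _)

  ∑-count-eqPath : ∀ {q k} {A : Set} (xs : List A) (f : A → Vec (Fin q) k) →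
                   ∑ (λ ℓ → count (λ x → eqPath (f x) ℓ) xs) (paths q k) ≡ length xs
  ∑-count-eqPath {q} {k} xs f = begin
    ∑ (λ ℓ → count (λ x → eqPath (f x) ℓ) xs) (paths q k)
      ≡⟨ ∑-cong (λ ℓ → count≡∑𝟙 _ xs) (paths q k) ⟩
    ∑ (λ ℓ → ∑ (λ x → 𝟙 (eqPath (f x) ℓ)) xs) (paths q k)
      ≡⟨ ∑-swap (λ ℓ x → 𝟙 (eqPath (f x) ℓ)) (paths q k) xs ⟩
    ∑ (λ x → ∑ (λ ℓ → 𝟙 (eqPath (f x) ℓ)) (paths q k)) xs
      ≡⟨ ∑-cong (∑𝟙-eqPath ∘ f) xs ⟩
    ∑ (λ _ → 1) xs
      ≡⟨ ∑1≡length xs ⟩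
    length xs ∎

  length-allVecs : {A : Set} (xs : List A) (m : ℕ) → length (allVecs xs m) ≡ length xs ℕ.^ m
  length-allVecs xs ℕ.zero    = refl
  length-allVecs xs (ℕ.suc m) = begin
    length (allVecs xs (ℕ.suc m))
      ≡⟨ ∑1≡length (allVecs xs (ℕ.suc m)) ⟨
    ∑ (λ _ → 1) (concatMap (λ x → map (x ∷_) (allVecs xs m)) xs)
      ≡⟨ ∑-concatMap _ _ xs ⟩
    ∑ (λ x → ∑ (λ _ → 1) (map (x ∷_) (allVecs xs m))) xs
      ≡⟨ ∑-cong (λ x → trans (∑-map _ (x ∷_) (allVecs xs m)) (∑1≡length (allVecs xs m))) xs ⟩
    ∑ (λ _ → length (allVecs xs m)) xs
      ≡⟨ ∑-const _ xs ⟩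
    length xs ℕ.* length (allVecs xs m)
      ≡⟨ cong (length xs ℕ.*_) (length-allVecs xs m) ⟩
    length xs ℕ.^ ℕ.suc m ∎

  length-allBits : (s : ℕ) → length (allBits s) ≡ 2 ℕ.^ s
  length-allBits = length-allVecs _

  length-allBlocks : (n k : ℕ) → length (allBlocks n k) ≡ 2 ℕ.^ (n ℕ.* k)
  length-allBlocks n k =
    trans (length-allVecs (allBits n) k) (trans (cong (ℕ._^ k) (length-allBits n)) (ℕₚ.^-*-assoc 2 n k))

open Counting
  using (count-combine-++; count-blocks-++; ∑-count-eqPath; length-allBits; length-allBlocks)

open import Data.Rational using (0ℚ; 1ℚ; ½; _/_; _*_; _-_; ∣_∣; _≤_; fromℚᵘ; nonNegative) renaming (_+_ to _+ℚ_)
open import Data.Rational.Properties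
  using (+-*-commutativeRing; toℚᵘ-injective; toℚᵘ-homo-*; toℚᵘ-homo-+; toℚᵘ-fromℚᵘ; fromℚᵘ-cong; /-cong;
         0/n≡0; nonNegative⁻¹; normalize-nonNeg; *-monoˡ-≤-nonNeg; +-mono-≤; ≤-refl; ∣p+q∣≤∣p∣+∣q∣;
         ∣p*q∣≡∣p∣*∣q∣; 0≤p⇒∣p∣≡p; *-identityˡ; *-identityʳ; *-distribˡ-+; module ≤-Reasoning)
open import Data.Rational.Unnormalised as ℚᵘ using (mkℚᵘ)
import Data.Rational.Unnormalised.Properties as ℚᵘₚ
open import Data.Rational.Solver using (module +-*-Solver)
open import Data.Integer as ℤ using (+_)
import Data.Integer.Properties as ℤₚ

module ℕ∑ = ListSum ℕₚ.+-*-commutativeSemiring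
open ListSum (CommutativeRing.commutativeSemiring +-*-commutativeRing)

fromℚᵘ-homo-* : ∀ x y → fromℚᵘ (x ℚᵘ.* y) ≡ fromℚᵘ x * fromℚᵘ y
fromℚᵘ-homo-* x y = toℚᵘ-injective
  (ℚᵘₚ.≃-trans (toℚᵘ-fromℚᵘ (x ℚᵘ.* y))
    (ℚᵘₚ.≃-sym (ℚᵘₚ.≃-trans (toℚᵘ-homo-* (fromℚᵘ x) (fromℚᵘ y)) (ℚᵘₚ.*-cong (toℚᵘ-fromℚᵘ x) (toℚᵘ-fromℚᵘ y)))))

fromℚᵘ-homo-+ : ∀ x y → fromℚᵘ (x ℚᵘ.+ y) ≡ fromℚᵘ x +ℚ fromℚᵘ y
fromℚᵘ-homo-+ x y = toℚᵘ-injective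
  (ℚᵘₚ.≃-trans (toℚᵘ-fromℚᵘ (x ℚᵘ.+ y))
    (ℚᵘₚ.≃-sym (ℚᵘₚ.≃-trans (toℚᵘ-homo-+ (fromℚᵘ x) (fromℚᵘ y)) (ℚᵘₚ.+-cong (toℚᵘ-fromℚᵘ x) (toℚᵘ-fromℚᵘ y)))))

a/d*b/e≡ab/de : ∀ a b d e .{{_ : ℕ.NonZero d}} .{{_ : ℕ.NonZero e}} →
                (+ a / d) * (+ b / e) ≡ (+ (a ℕ.* b) / (d ℕ.* e)) {{ℕₚ.m*n≢0 d e}}
a/d*b/e≡ab/de a b (ℕ.suc d) (ℕ.suc e) =
  trans (sym (fromℚᵘ-homo-* (mkℚᵘ (+ a) d) (mkℚᵘ (+ b) e))) (/-cong (sym (ℤₚ.pos-* a b)) refl)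

a/d+b/d≡[a+b]/d : ∀ a b d .{{_ : ℕ.NonZero d}} → (+ a / d) +ℚ (+ b / d) ≡ + (a + b) / d
a/d+b/d≡[a+b]/d a b (ℕ.suc d) =
  trans (sym (fromℚᵘ-homo-+ (mkℚᵘ (+ a) d) (mkℚᵘ (+ b) d))) (fromℚᵘ-cong a/d+b/d≃)
  where
    a/d+b/d≃ : mkℚᵘ (+ a) d ℚᵘ.+ mkℚᵘ (+ b) d ℚᵘ.≃ mkℚᵘ (+ (a + b)) d
    a/d+b/d≃ =
      ℚᵘₚ.≃-trans (ℚᵘₚ.≃-reflexive (ℚᵘₚ./-cong (sym (ℤₚ.*-distribʳ-+ (+ ℕ.suc d) (+ a) (+ b))) refl))
        (ℚᵘₚ.≃-trans (ℚᵘₚ.*-cancelʳ-/ (ℕ.suc d) {+ a ℤ.+ + b} {ℕ.suc d})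
          (ℚᵘₚ.≃-reflexive (ℚᵘₚ./-cong (sym (ℤₚ.pos-+ a b)) refl)))

d/d≡1 : ∀ d .{{_ : ℕ.NonZero d}} → + d / d ≡ 1ℚ
d/d≡1 (ℕ.suc d) = fromℚᵘ-cong {mkℚᵘ (+ ℕ.suc d) d} {mkℚᵘ (+ 1) 0} (ℚᵘ.*≡* (ℤₚ.*-comm (+ ℕ.suc d) (+ 1)))

∑-a/d : {A : Set} (a : A → ℕ) (d : ℕ) .{{_ : ℕ.NonZero d}} (xs : List A) →
        ∑ (λ x → + a x / d) xs ≡ + ℕ∑.∑ a xs / d
∑-a/d a d []       = sym (0/n≡0 d)
∑-a/d a d (x ∷ xs) = trans (cong ((+ a x / d) +ℚ_) (∑-a/d a d xs)) (a/d+b/d≡[a+b]/d (a x) _ d)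

prob-≥0 : {A : Set} (m : ℕ) (xs : List A) (p : A → Bool) → 0ℚ ≤ prob m xs p
prob-≥0 m xs p = nonNegative⁻¹ _ {{normalize-nonNeg (count p xs) (2 ℕ.^ m) {{ℕₚ.m^n≢0 2 m}}}}

prob-* : {A B C : Set} (m₁ m₂ : ℕ) (xs : List A) (ys : List B) (zs : List C)
         {p : A → Bool} {p₁ : B → Bool} {p₂ : C → Bool} → count p xs ≡ count p₁ ys ℕ.* count p₂ zs →
         prob (m₁ + m₂) xs p ≡ prob m₁ ys p₁ * prob m₂ zs p₂
prob-* m₁ m₂ xs ys zs {p₁ = p₁} {p₂} count≡ =
  sym (trans (a/d*b/e≡ab/de (count p₁ ys) (count p₂ zs) (2 ℕ.^ m₁) (2 ℕ.^ m₂))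
             (/-cong {{ℕₚ.m*n≢0 (2 ℕ.^ m₁) (2 ℕ.^ m₂)}} (cong +_ (sym count≡))
                     (sym (ℕₚ.^-distribˡ-+-* 2 m₁ m₂))))
  where instance
    2^m₁≢0 = ℕₚ.m^n≢0 2 m₁
    2^m₂≢0 = ℕₚ.m^n≢0 2 m₂
    2^m≢0  = ℕₚ.m^n≢0 2 (m₁ + m₂)

∑-prob-eqPath≡1 : ∀ {q k} {A : Set} (m : ℕ) (xs : List A) (f : A → Vec (Fin q) k) → length xs ≡ 2 ℕ.^ m →
                  ∑ (λ ℓ → prob m xs (λ x → eqPath (f x) ℓ)) (paths q k) ≡ 1ℚ
∑-prob-eqPath≡1 {q} {k} m xs f length≡ =
  trans (∑-a/d (λ ℓ → count (λ x → eqPath (f x) ℓ) xs) (2 ℕ.^ m) (paths q k))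
    (trans (/-cong (cong +_ (trans (∑-count-eqPath xs f) length≡)) refl) (d/d≡1 (2 ℕ.^ m)))
  where instance
    2^m≢0 = ℕₚ.m^n≢0 2 m

sumℚ-map : {A : Set} (f : A → ℚ) (xs : List A) → sumℚ (map f xs) ≡ ∑ f xs
sumℚ-map f []       = refl
sumℚ-map f (x ∷ xs) = cong (f x +ℚ_) (sumℚ-map f xs)

∑-mono-≤ : {A : Set} {f g : A → ℚ} → (∀ x → f x ≤ g x) → (xs : List A) → ∑ f xs ≤ ∑ g xs
∑-mono-≤ f≤g []       = ≤-refl
∑-mono-≤ f≤g (x ∷ xs) = +-mono-≤ (f≤g x) (∑-mono-≤ f≤g xs)

∑-convex-≤ : {A : Set} {w f : A → ℚ} {c : ℚ} (xs : List A) → (∀ x → 0ℚ ≤ w x) → ∑ w xs ≡ 1ℚ →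
             (∀ x → f x ≤ c) → ∑ (λ x → w x * f x) xs ≤ c
∑-convex-≤ {w = w} {f} {c} xs w≥0 ∑w≡1 f≤c = begin
  ∑ (λ x → w x * f x) xs  ≤⟨ ∑-mono-≤ (λ x → *-monoˡ-≤-nonNeg (w x) {{nonNegative (w≥0 x)}} (f≤c x)) xs ⟩
  ∑ (λ x → w x * c) xs    ≡⟨ ∑-*ʳ c w xs ⟩
  ∑ w xs * c              ≡⟨ cong (_* c) ∑w≡1 ⟩
  1ℚ * c                  ≡⟨ *-identityˡ c ⟩
  c                       ∎
  where open ≤-Reasoning

∣p*q-r*s∣≤∣p-r∣*q+r*∣q-s∣ : ∀ p q r s → 0ℚ ≤ q → 0ℚ ≤ r → ∣ p * q - r * s ∣ ≤ ∣ p - r ∣ * q +ℚ r * ∣ q - s ∣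
∣p*q-r*s∣≤∣p-r∣*q+r*∣q-s∣ p q r s 0≤q 0≤r = begin
  ∣ p * q - r * s ∣
    ≡⟨ cong ∣_∣ (solve 4 (λ p q r s → p :* q :- r :* s := (p :- r) :* q :+ r :* (q :- s)) refl p q r s) ⟩
  ∣ (p - r) * q +ℚ r * (q - s) ∣
    ≤⟨ ∣p+q∣≤∣p∣+∣q∣ ((p - r) * q) (r * (q - s)) ⟩
  ∣ (p - r) * q ∣ +ℚ ∣ r * (q - s) ∣
    ≡⟨ cong₂ _+ℚ_ (trans (∣p*q∣≡∣p∣*∣q∣ (p - r) q) (cong (∣ p - r ∣ *_) (0≤p⇒∣p∣≡p 0≤q)))
                  (trans (∣p*q∣≡∣p∣*∣q∣ r (q - s)) (cong (_* ∣ q - s ∣) (0≤p⇒∣p∣≡p 0≤r))) ⟩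
  ∣ p - r ∣ * q +ℚ r * ∣ q - s ∣ ∎
  where
    open ≤-Reasoning
    open +-*-Solver

tv : {A : Set} → List A → (A → ℚ) → (A → ℚ) → ℚ
tv xs p r = ½ * ∑ (λ x → ∣ p x - r x ∣) xs

tv-product-≤ : {U V : Set} (us : List U) (vs : List V) (p r : U → ℚ) (q s : U → V → ℚ) →
               (∀ u → 0ℚ ≤ r u) → (∀ u v → 0ℚ ≤ q u v) → (∀ u → ∑ (q u) vs ≡ 1ℚ) →
               ½ * ∑ (λ u → ∑ (λ v → ∣ p u * q u v - r u * s u v ∣) vs) us
                 ≤ tv us p r +ℚ ∑ (λ u → r u * tv vs (q u) (s u)) us
tv-product-≤ us vs p r q s r≥0 q≥0 ∑q≡1 = begin
  ½ * ∑ (λ u → ∑ (λ v → ∣ p u * q u v - r u * s u v ∣) vs) us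
    ≤⟨ *-monoˡ-≤-nonNeg ½ (∑-mono-≤ (λ u → ∑-mono-≤ (λ v →
         ∣p*q-r*s∣≤∣p-r∣*q+r*∣q-s∣ (p u) (q u v) (r u) (s u v) (q≥0 u v) (r≥0 u)) vs) us) ⟩
  ½ * ∑ (λ u → ∑ (λ v → ∣ p u - r u ∣ * q u v +ℚ r u * ∣ q u v - s u v ∣) vs) us
    ≡⟨ cong (½ *_) (∑-cong sumOverV us) ⟩
  ½ * ∑ (λ u → ∣ p u - r u ∣ +ℚ r u * ∑ (λ v → ∣ q u v - s u v ∣) vs) us
    ≡⟨ cong (½ *_) (∑-⊕ _ _ us) ⟩
  ½ * (∑ (λ u → ∣ p u - r u ∣) us +ℚ ∑ (λ u → r u * ∑ (λ v → ∣ q u v - s u v ∣) vs) us)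
    ≡⟨ *-distribˡ-+ ½ (∑ (λ u → ∣ p u - r u ∣) us) _ ⟩
  tv us p r +ℚ ½ * ∑ (λ u → r u * ∑ (λ v → ∣ q u v - s u v ∣) vs) us
    ≡⟨ cong (tv us p r +ℚ_) (trans (∑-cong (λ u → x∙yz≈y∙xz (r u) ½ _) us) (∑-*ˡ ½ _ us)) ⟨
  tv us p r +ℚ ∑ (λ u → r u * tv vs (q u) (s u)) us ∎
  where
    open ≤-Reasoning
    open import Algebra.Properties.CommutativeSemigroup
      (CommutativeRing.*-commutativeSemigroup +-*-commutativeRing) using (x∙yz≈y∙xz)
    sumOverV : ∀ u → ∑ (λ v → ∣ p u - r u ∣ * q u v +ℚ r u * ∣ q u v - s u v ∣) vs
                     ≡ ∣ p u - r u ∣ +ℚ r u * ∑ (λ v → ∣ q u v - s u v ∣) vs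
    sumOverV u = trans (∑-⊕ _ _ vs)
      (cong₂ _+ℚ_ (trans (∑-*ˡ ∣ p u - r u ∣ (q u) vs)
                         (trans (cong (∣ p u - r u ∣ *_) (∑q≡1 u)) (*-identityʳ ∣ p u - r u ∣)))
                  (∑-*ˡ (r u) _ vs))

module _ {n q : ℕ} where

  pathProb : ∀ {k s} → BDT n q k → (Bits s → Blocks n k) → Vec (Fin q) k → ℚ
  pathProb {s = s} T gen ℓ = prob s (allBits s) (λ x → eqPath (run T (gen x)) ℓ)

  uniformPathProb : ∀ {k} → BDT n q k → Vec (Fin q) k → ℚ
  uniformPathProb {k} T ℓ = prob (n ℕ.* k) (allBlocks n k) (λ X → eqPath (run T X) ℓ)

  tvDist≡tv : ∀ {k s} (T : BDT n q k) (gen : Bits s → Blocks n k) →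
              tvDist T gen ≡ tv (paths q k) (pathProb T gen) (uniformPathProb T)
  tvDist≡tv {k} T gen = cong (½ *_) (sumℚ-map _ (paths q k))

  uniformPathProb-≥0 : ∀ {k} (T : BDT n q k) (ℓ : Vec (Fin q) k) → 0ℚ ≤ uniformPathProb T ℓ
  uniformPathProb-≥0 {k} T ℓ = prob-≥0 (n ℕ.* k) (allBlocks n k) (λ X → eqPath (run T X) ℓ)

  pathProb-≥0 : ∀ {k s} (T : BDT n q k) (gen : Bits s → Blocks n k) (ℓ : Vec (Fin q) k) → 0ℚ ≤ pathProb T gen ℓ
  pathProb-≥0 {s = s} T gen ℓ = prob-≥0 s (allBits s) (λ x → eqPath (run T (gen x)) ℓ)

  ∑-uniformPathProb≡1 : ∀ {k} (T : BDT n q k) → ∑ (uniformPathProb T) (paths q k) ≡ 1ℚ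
  ∑-uniformPathProb≡1 {k} T = ∑-prob-eqPath≡1 (n ℕ.* k) (allBlocks n k) (run T) (length-allBlocks n k)

  ∑-pathProb≡1 : ∀ {k s} (T : BDT n q k) (gen : Bits s → Blocks n k) → ∑ (pathProb T gen) (paths q k) ≡ 1ℚ
  ∑-pathProb≡1 {s = s} T gen = ∑-prob-eqPath≡1 s (allBits s) (run T ∘ gen) (length-allBits s)

  pathProb-combine-++ : ∀ {k₁ k₂ s₁ s₂} (T : BDT n q (k₁ + k₂))
                        (g₁ : Bits s₁ → Blocks n k₁) (g₂ : Bits s₂ → Blocks n k₂)
                        (u : Vec (Fin q) k₁) (v : Vec (Fin q) k₂) →
                        pathProb T (combine g₁ g₂) (u ++ v)
                          ≡ pathProb (prefix k₁ T) g₁ u * pathProb (subtree k₁ T u) g₂ v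
  pathProb-combine-++ {s₁ = s₁} {s₂} T g₁ g₂ u v =
    prob-* s₁ s₂ (allBits (s₁ + s₂)) (allBits s₁) (allBits s₂) (count-combine-++ T g₁ g₂ u v)

  uniformPathProb-++ : ∀ {k₁ k₂} (T : BDT n q (k₁ + k₂)) (u : Vec (Fin q) k₁) (v : Vec (Fin q) k₂) →
                       uniformPathProb T (u ++ v)
                         ≡ uniformPathProb (prefix k₁ T) u * uniformPathProb (subtree k₁ T u) v
  uniformPathProb-++ {k₁} {k₂} T u v =
    trans (cong (λ m → prob m (allBlocks n (k₁ + k₂)) (λ X → eqPath (run T X) (u ++ v)))
                (ℕₚ.*-distribˡ-+ n k₁ k₂))
          (prob-* (n ℕ.* k₁) (n ℕ.* k₂) (allBlocks n (k₁ + k₂)) (allBlocks n k₁) (allBlocks n k₂)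
                  (count-blocks-++ T u v))

  tvDist-combine-≤ : ∀ {k₁ k₂ s₁ s₂} (T : BDT n q (k₁ + k₂))
                     (g₁ : Bits s₁ → Blocks n k₁) (g₂ : Bits s₂ → Blocks n k₂) →
                     tvDist T (combine g₁ g₂)
                       ≤ tvDist (prefix k₁ T) g₁
                         +ℚ ∑ (λ u → uniformPathProb (prefix k₁ T) u * tvDist (subtree k₁ T u) g₂) (paths q k₁)
  tvDist-combine-≤ {k₁} {k₂} T g₁ g₂ = begin
    tvDist T (combine g₁ g₂)
      ≡⟨ tvDist≡tv T (combine g₁ g₂) ⟩
    ½ * ∑ (λ w → ∣ pathProb T (combine g₁ g₂) w - uniformPathProb T w ∣) (paths q (k₁ + k₂))
      ≡⟨ cong (½ *_) (∑-allVecs-+ (allFin q) k₁ k₂ _) ⟩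
    ½ * ∑ (λ u → ∑ (λ v → ∣ pathProb T (combine g₁ g₂) (u ++ v) - uniformPathProb T (u ++ v) ∣)
                   (paths q k₂)) (paths q k₁)
      ≡⟨ cong (½ *_) (∑-cong (λ u → ∑-cong (λ v → cong₂ (λ a b → ∣ a - b ∣)
           (pathProb-combine-++ T g₁ g₂ u v) (uniformPathProb-++ T u v)) (paths q k₂)) (paths q k₁)) ⟩
    ½ * ∑ (λ u → ∑ (λ v → ∣ P u * Q u v - R u * S u v ∣) (paths q k₂)) (paths q k₁)
      ≤⟨ tv-product-≤ (paths q k₁) (paths q k₂) P R Q S (uniformPathProb-≥0 T₁)
                      (λ u → pathProb-≥0 (subtree k₁ T u) g₂) (λ u → ∑-pathProb≡1 (subtree k₁ T u) g₂) ⟩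
    tv (paths q k₁) P R +ℚ ∑ (λ u → R u * tv (paths q k₂) (Q u) (S u)) (paths q k₁)
      ≡⟨ cong₂ _+ℚ_ (tvDist≡tv T₁ g₁)
                    (∑-cong (λ u → cong (R u *_) (tvDist≡tv (subtree k₁ T u) g₂)) (paths q k₁)) ⟨
    tvDist T₁ g₁ +ℚ ∑ (λ u → R u * tvDist (subtree k₁ T u) g₂) (paths q k₁) ∎
    where
      open ≤-Reasoning
      T₁ = prefix k₁ T
      P = pathProb T₁ g₁
      R = uniformPathProb T₁
      Q = λ u → pathProb (subtree k₁ T u) g₂
      S = λ u → uniformPathProb (subtree k₁ T u)

lemma3p3 : (n q s₁ s₂ k₁ k₂ : ℕ) (γ₁ γ₂ : ℚ)
    (Gen₁ : Bits s₁ → Blocks n k₁) (Gen₂ : Bits s₂ → Blocks n k₂) →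
    IsPRG n q k₁ s₁ Gen₁ γ₁ → IsPRG n q k₂ s₂ Gen₂ γ₂ →
    IsPRG n q (k₁ + k₂) (s₁ + s₂) (combine Gen₁ Gen₂) (γ₁ Data.Rational.+ γ₂)
lemma3p3 n q s₁ s₂ k₁ k₂ γ₁ γ₂ Gen₁ Gen₂ prg₁ prg₂ T = begin
  tvDist T (combine Gen₁ Gen₂)
    ≤⟨ tvDist-combine-≤ T Gen₁ Gen₂ ⟩
  tvDist T₁ Gen₁ +ℚ ∑ (λ u → uniformPathProb T₁ u * tvDist (subtree k₁ T u) Gen₂) (paths q k₁)
    ≤⟨ +-mono-≤ (prg₁ T₁) (∑-convex-≤ (paths q k₁) (uniformPathProb-≥0 T₁) (∑-uniformPathProb≡1 T₁)
                                       (λ u → prg₂ (subtree k₁ T u))) ⟩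
  γ₁ +ℚ γ₂ ∎
  where
    open ≤-Reasoning
    T₁ = prefix k₁ T
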